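{- For every $n>0$ there is a triangulation $T$ of the torus with $n \leq |V(T)|$ such that $T$ has a non-degenerated antiferromagnetic groundstate.
   Context: A triangulation of a closed surface is an embedding of a graph in the surface such that each face boundary is a $3$-cycle of the graph. A state (spin-assignment) on a triangulation $T$ is a function $\sigma: V(T)\to\{+1,-1\}$. The antiferromagnetic Ising energy of $\sigma$ is $H(\sigma)=\sum_{uv\in E(T)}\sigma_u\sigma_v$. A groundstate is a state minimizing $H$. Since $H(\sigma)=H(-\sigma)$, groundstates come in pairs $\{\sigma,-\sigma\}$; the groundstate is called non-degenerated if $T$ has exactly two groundstates (i.e. exactly one pair $\sigma,-\sigma$), and degenerated if it has more than two. -}

module Defs where

open import Data.Nat using (ℕ; _≤_; _<?_)
open import Data.Fin using (Fin; toℕ; _≟_)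
open import Data.Integer as ℤ using (ℤ; +_; -_)
open import Data.Product using (_×_; _,_; Σ)
open import Data.Sum using (_⊎_; inj₁; inj₂)
open import Data.Sign using (Sign; opposite)
open import Data.List using (List; length; filter; map; foldr; allFin; cartesianProduct)
open import Data.List.Relation.Unary.Any using (Any; any?)
open import Data.List.Relation.Unary.All using (All)
open import Relation.Binary.PropositionalEquality using (_≡_; _≢_)
open import Relation.Binary.Construct.Closure.ReflexiveTransitive using (Star)
open import Relation.Nullary using (Dec; ¬_)
open import Relation.Nullary.Decidable using (_×-dec_; _⊎-dec_)

-- An (oriented) triangular face on vertex set Fin n: an ordered triple (a , b , c),
-- read cyclically; its directed boundary edges are a→b, b→c, c→a.
Face : ℕ → Set
Face n = Fin n × Fin n × Fin n

HasDir : ∀ {n} → Face n → Fin n → Fin n → Set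
HasDir (a , b , c) u v = (u ≡ a × v ≡ b) ⊎ ((u ≡ b × v ≡ c) ⊎ (u ≡ c × v ≡ a))

hasDir? : ∀ {n} (f : Face n) (u v : Fin n) → Dec (HasDir f u v)
hasDir? (a , b , c) u v =
  ((u ≟ a) ×-dec (v ≟ b)) ⊎-dec (((u ≟ b) ×-dec (v ≟ c)) ⊎-dec ((u ≟ c) ×-dec (v ≟ a)))

Adj : ∀ {n} → List (Face n) → Fin n → Fin n → Set
Adj F u v = Any (λ f → HasDir f u v) F

adj? : ∀ {n} (F : List (Face n)) (u v : Fin n) → Dec (Adj F u v)
adj? F u v = any? (λ f → hasDir? f u v) F

dirCount : ∀ {n} → List (Face n) → Fin n → Fin n → ℕ
dirCount F u v = length (filter (λ f → hasDir? f u v) F)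

-- rotation around v: a is followed by b iff some face is (v , a , b) up to cyclic rotation
Next : ∀ {n} → List (Face n) → Fin n → Fin n → Fin n → Set
Next F v a b = Any (λ f → HasDir f v a × HasDir f a b) F

edgeList : ∀ {n} → List (Face n) → List (Fin n × Fin n)
edgeList {n} F =
  filter (λ p → (toℕ (Data.Product.proj₁ p) <? toℕ (Data.Product.proj₂ p))
                  ×-dec adj? F (Data.Product.proj₁ p) (Data.Product.proj₂ p))
         (cartesianProduct (allFin n) (allFin n))

-- Combinatorial description of a triangulation of the torus (a connected closed
-- orientable surface of Euler characteristic 0) with simple underlying graph.
record IsTorusTriangulation (n : ℕ) (F : List (Face n)) : Set where
  field
    faceDistinct : All (λ f → let (a , b , c) = f in a ≢ b × b ≢ c × c ≢ a) F
    -- coherent orientation: each directed edge lies in at most one face,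
    -- and every edge is traversed in both directions (so lies in exactly two faces)
    dirUnique    : ∀ u v → dirCount F u v ≤ 1
    dirSym       : ∀ u v → Adj F u v → Adj F v u
    -- the link of every vertex is a single cycle (manifold condition)
    linkCycle    : ∀ v a b → Adj F v a → Adj F v b → Star (Next F v) a b
    connected    : ∀ u v → Star (Adj F) u v
    euler        : (+ n ℤ.- + length (edgeList F)) ℤ.+ + length F ≡ + 0

record TorusTriangulation : Set where
  field
    nV      : ℕ
    faces   : List (Face nV)
    isTorus : IsTorusTriangulation nV faces
open TorusTriangulation public

spin : Sign → ℤ
spin Sign.+ = + 1
spin Sign.- = - (+ 1)

State : TorusTriangulation → Set
State T = Fin (nV T) → Sign

energy : (T : TorusTriangulation) → State T → ℤ
energy T σ = foldr ℤ._+_ (+ 0) (map (λ p → spin (σ (Data.Product.proj₁ p)) ℤ.* spin (σ (Data.Product.proj₂ p)))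
                      (edgeList (faces T)))

Groundstate : (T : TorusTriangulation) → State T → Set
Groundstate T σ = ∀ τ → energy T σ ℤ.≤ energy T τ

NonDegenerate : TorusTriangulation → Set
NonDegenerate T = Σ (State T) λ σ → Groundstate T σ ×
  (∀ τ → Groundstate T τ → (∀ v → τ v ≡ σ v) ⊎ (∀ v → τ v ≡ opposite (σ v)))

module Submission where

open import Defs
open import Data.Nat as ℕ using (ℕ; zero; suc; _<_; _≤_; z≤n)
import Data.Nat.Properties as ℕP
open import Data.Nat.ListAction using (sum)
open import Data.Fin using (Fin; zero; suc; toℕ; _≟_)
open import Data.Fin.Patterns
import Data.Fin.Properties as FinP
open import Data.Integer as ℤ using (ℤ; +_; _+_; _*_; _-_; +≤+)
import Data.Integer.Properties as ℤP
open import Data.Integer.Tactic.RingSolver using (solve-∀)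
open import Algebra.Properties.CommutativeMonoid.Sum ℤP.+-0-commutativeMonoid
  using (sum-syntax; ∑-distrib-+; ∑-comm; sum-cong-≗; sum-replicate-zero)
open import Data.Bool using (Bool; true; false; _∧_; _∨_; if_then_else_)
open import Data.Sign using (Sign; opposite)
import Data.Sign.Properties as SignP
open import Data.Empty using (⊥-elim)
open import Data.Product using (Σ; _×_; _,_; proj₁; proj₂)
open import Data.Sum using (_⊎_; inj₁; inj₂)
open import Data.List
  using (List; []; _∷_; _∷ʳ_; _++_; length; map; foldr; filter; allFin; tabulate; cartesianProduct)
open import Data.List.NonEmpty as List⁺ using (List⁺; _∷_; toList)
import Data.List.Properties as ListP
open import Data.List.Relation.Unary.Any using (here; there; any?)
import Data.List.Relation.Unary.Any as Any
import Data.List.Relation.Unary.Any.Properties as AnyP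
open import Data.List.Relation.Unary.All using (All; []; _∷_)
import Data.List.Relation.Unary.All as All
import Data.List.Relation.Unary.All.Properties as AllP
open import Data.List.Relation.Unary.Linked using (Linked; _∷_; linked?)
import Data.List.Relation.Unary.Linked as Linked
open import Data.List.Membership.Propositional using (_∈_)
open import Data.List.Membership.DecPropositional (_≟_ {9}) using (_∈?_)
open import Data.Vec.Functional using () renaming (_∷_ to _◂_)
open import Relation.Binary.Definitions using (tri<; tri≈; tri>)
open import Relation.Binary.PropositionalEquality
  using (_≡_; _≢_; _≗_; refl; sym; trans; cong; cong₂; subst; subst₂; ≢-sym; module ≡-Reasoning)
open import Relation.Binary.Construct.Closure.ReflexiveTransitive
  using (Star; ε; _◅_; _◅◅_; gmap; kleisliStar; reverse)
open import Relation.Nullary using (Dec; yes; no; ¬_; does)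
open import Relation.Nullary.Decidable
  using (from-yes; map′; dec-true; dec-false; _×-dec_; _⊎-dec_; _→-dec_; ¬?)
open import Function using (_∘_; case_of_)

-- Every edge lies in exactly two faces, and the three spin products around a triangle sum
-- to 3 if it is monochromatic and to −1 otherwise; hence 2 H(σ) + |F| = 4 · #(monochromatic
-- faces of σ), and whenever some state has no monochromatic face the groundstates are exactly
-- those states. The join K₃ + C₆ on the torus has only the two such states ± (triangle +,
-- hexagon −). Stacking a new vertex v into a face (a, b, c) whose corners b, c have opposite
-- spins keeps a torus (V, E, F grow by 1, 3, 2), and the new faces (v, a, b), (v, c, a)
-- force the spin of v to be −σ(a); stacking again into the new face (v, b, c) repeats this.

pattern edge₁ = inj₁ (refl , refl)
pattern edge₂ = inj₂ (inj₁ (refl , refl))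
pattern edge₃ = inj₂ (inj₂ (refl , refl))

-- Triangulated surfaces and stacking

DirUnique : ∀ {n} → List (Face n) → Set
DirUnique F = ∀ u v → dirCount F u v ≤ 1

module _ {n} {f : Face n} {F : List (Face n)} {u v : Fin n} where

  dirCount-accept : HasDir f u v → dirCount (f ∷ F) u v ≡ suc (dirCount F u v)
  dirCount-accept p = cong length (ListP.filter-accept (λ g → hasDir? g u v) p)

  dirCount-reject : ¬ HasDir f u v → dirCount (f ∷ F) u v ≡ dirCount F u v
  dirCount-reject ¬p = cong length (ListP.filter-reject (λ g → hasDir? g u v) ¬p)

  dirCount-∷ : dirCount F u v ≤ dirCount (f ∷ F) u v
  dirCount-∷ = case hasDir? f u v of λ where
    (yes p)  → subst (dirCount F u v ≤_) (sym (dirCount-accept p)) (ℕP.n≤1+n _)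
    (no ¬p) → ℕP.≤-reflexive (sym (dirCount-reject ¬p))

dirCount-none : ∀ {n} (F : List (Face n)) {u v} → ¬ Adj F u v → dirCount F u v ≡ 0
dirCount-none F ¬uv = cong length (ListP.filter-none (λ g → hasDir? g _ _) (AllP.¬Any⇒All¬ F ¬uv))

dirUnique-[] : ∀ {n} → DirUnique {n} []
dirUnique-[] _ _ = z≤n

dirUnique-∷ : ∀ {n} {f : Face n} {F} →
  DirUnique F → (∀ {u v} → HasDir f u v → ¬ Adj F u v) → DirUnique (f ∷ F)
dirUnique-∷ {f = f} {F} uniq fresh u v = case hasDir? f u v of λ where
  (yes p)  → ℕP.≤-reflexive (trans (dirCount-accept p) (cong suc (dirCount-none F (fresh p))))
  (no ¬p) → subst (_≤ 1) (sym (dirCount-reject ¬p)) (uniq u v)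

dirUnique-tail : ∀ {n} {f : Face n} {F} → DirUnique (f ∷ F) → DirUnique F
dirUnique-tail {f = f} {F} uniq u v = ℕP.≤-trans (dirCount-∷ {f = f} {F}) (uniq u v)

dirUnique-head : ∀ {n} {f : Face n} {F} → DirUnique (f ∷ F) →
  ∀ {u v} → HasDir f u v → ¬ Adj F u v
dirUnique-head {f = f} {F} uniq {u} {v} p uv =
  ℕP.<⇒≱ (ListP.filter-some (λ g → hasDir? g u v) uv)
         (ℕP.≤-pred (subst (_≤ 1) (dirCount-accept {f = f} {F} p) (uniq u v)))

FaceDistinct : ∀ {n} → Face n → Set
FaceDistinct f = let (a , b , c) = f in a ≢ b × b ≢ c × c ≢ a

record IsSurface (n : ℕ) (F : List (Face n)) : Set where
  field
    faceDistinct : All FaceDistinct F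
    dirUnique    : DirUnique F
    dirSym       : ∀ u v → Adj F u v → Adj F v u
    linkCycle    : ∀ v a b → Adj F v a → Adj F v b → Star (Next F v) a b
    connected    : ∀ u v → Star (Adj F) u v

shift : ∀ {n} → Face n → Face (suc n)
shift (x , y , z) = (suc x , suc y , suc z)

cone : ∀ {n} → Fin n → Fin n → Face (suc n)
cone p q = (zero , suc p , suc q)

stack : ∀ {n} → List⁺ (Face n) → List⁺ (Face (suc n))
stack ((a , b , c) ∷ G) = cone b c ∷ cone a b ∷ cone c a ∷ map shift G

data Shifted {n} (R : Fin n → Fin n → Set) : Fin (suc n) → Fin (suc n) → Set where
  shifted : ∀ {x y} → R x y → Shifted R (suc x) (suc y)

HasDir-shift⁺ : ∀ {n} (f : Face n) {x y} → HasDir f x y → HasDir (shift f) (suc x) (suc y)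
HasDir-shift⁺ _ edge₁ = edge₁
HasDir-shift⁺ _ edge₂ = edge₂
HasDir-shift⁺ _ edge₃ = edge₃

HasDir-shift⁻ : ∀ {n} (f : Face n) {u v} → HasDir (shift f) u v → Shifted (HasDir f) u v
HasDir-shift⁻ _ edge₁ = shifted edge₁
HasDir-shift⁻ _ edge₂ = shifted edge₂
HasDir-shift⁻ _ edge₃ = shifted edge₃

Adj-shift⁺ : ∀ {n} {G : List (Face n)} {x y} → Adj G x y → Adj (map shift G) (suc x) (suc y)
Adj-shift⁺ = AnyP.map⁺ ∘ Any.map (HasDir-shift⁺ _)

Adj-shift⁻ : ∀ {n} (G : List (Face n)) {u v} → Adj (map shift G) u v → Shifted (Adj G) u v
Adj-shift⁻ (f ∷ G) (here uv) with HasDir-shift⁻ f uv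
... | shifted xy = shifted (here xy)
Adj-shift⁻ (f ∷ G) (there uv) with Adj-shift⁻ G uv
... | shifted xy = shifted (there xy)

Next-shift⁺ : ∀ {n} {G : List (Face n)} {w x y} → Next G w x y → Next (map shift G) (suc w) (suc x) (suc y)
Next-shift⁺ = AnyP.map⁺ ∘ Any.map (λ {f} (wx , xy) → HasDir-shift⁺ f wx , HasDir-shift⁺ f xy)

faceDistinct-shift : ∀ {n} {f : Face n} → FaceDistinct f → FaceDistinct (shift f)
faceDistinct-shift (x≢y , y≢z , z≢x) =
  x≢y ∘ FinP.suc-injective , y≢z ∘ FinP.suc-injective , z≢x ∘ FinP.suc-injective

dirUnique-shift : ∀ {n} (G : List (Face n)) → DirUnique G → DirUnique (map shift G)
dirUnique-shift []      _    = dirUnique-[]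
dirUnique-shift (f ∷ G) uniq = dirUnique-∷ (dirUnique-shift G (dirUnique-tail uniq)) fresh
  where
  fresh : ∀ {u v} → HasDir (shift f) u v → ¬ Adj (map shift G) u v
  fresh uv uv′ with HasDir-shift⁻ f uv | Adj-shift⁻ G uv′
  ... | shifted xy | shifted xy′ = dirUnique-head uniq xy xy′

cone-distinct : ∀ {n} {p q : Fin n} → p ≢ q → FaceDistinct (cone p q)
cone-distinct p≢q = (λ ()) , p≢q ∘ FinP.suc-injective , (λ ())

cone-disjoint : ∀ {n} {p q p′ q′ : Fin n} → p ≢ p′ → q ≢ q′ →
  ∀ {u v} → HasDir (cone p q) u v → ¬ HasDir (cone p′ q′) u v
cone-disjoint p≢p′ _ edge₁ (inj₁ (_ , e))       = p≢p′ (FinP.suc-injective e)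
cone-disjoint _    _ edge₁ (inj₂ (inj₁ (() , _)))
cone-disjoint _    _ edge₁ (inj₂ (inj₂ (() , _)))
cone-disjoint _    _ edge₂ (inj₁ (() , _))
cone-disjoint p≢p′ _ edge₂ (inj₂ (inj₁ (e , _))) = p≢p′ (FinP.suc-injective e)
cone-disjoint _    _ edge₂ (inj₂ (inj₂ (_ , ())))
cone-disjoint _    _ edge₃ (inj₁ (() , _))
cone-disjoint _    _ edge₃ (inj₂ (inj₁ (_ , ())))
cone-disjoint _ q≢q′ edge₃ (inj₂ (inj₂ (e , _))) = q≢q′ (FinP.suc-injective e)

cone-shift : ∀ {n} (G : List (Face n)) {p q u v} →
  HasDir (cone p q) u v → Adj (map shift G) u v → Adj G p q
cone-shift G edge₁ uv with Adj-shift⁻ G uv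
... | ()
cone-shift G edge₂ uv with Adj-shift⁻ G uv
... | shifted pq = pq
cone-shift G edge₃ uv with Adj-shift⁻ G uv
... | ()

module Stacking {n} {a b c : Fin n} {G : List (Face n)}
                (surface : IsSurface n ((a , b , c) ∷ G)) where
  open IsSurface surface

  F : List (Face n)
  F = (a , b , c) ∷ G

  F′ : List (Face (suc n))
  F′ = toList (stack ((a , b , c) ∷ G))

  a≢b : a ≢ b
  a≢b = proj₁ (All.head faceDistinct)
  b≢c : b ≢ c
  b≢c = proj₁ (proj₂ (All.head faceDistinct))
  c≢a : c ≢ a
  c≢a = proj₂ (proj₂ (All.head faceDistinct))

  faceDistinct′ : All FaceDistinct F′
  faceDistinct′ = cone-distinct b≢c ∷ cone-distinct a≢b ∷ cone-distinct c≢a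
                ∷ AllP.map⁺ (All.map faceDistinct-shift (All.tail faceDistinct))

  dirUnique′ : DirUnique F′
  dirUnique′ = dirUnique-∷ (dirUnique-∷ (dirUnique-∷ tail-unique fresh-ca) fresh-ab) fresh-bc
    where
    tail-unique : DirUnique (map shift G)
    tail-unique = dirUnique-shift G (dirUnique-tail dirUnique)
    old-fresh : ∀ {p q u v} → HasDir (a , b , c) p q → HasDir (cone p q) u v → ¬ Adj (map shift G) u v
    old-fresh pq uv = dirUnique-head dirUnique pq ∘ cone-shift G uv

    fresh-ca : ∀ {u v} → HasDir (cone c a) u v → ¬ Adj (map shift G) u v
    fresh-ca = old-fresh edge₃
    fresh-ab : ∀ {u v} → HasDir (cone a b) u v → ¬ Adj (cone c a ∷ map shift G) u v
    fresh-ab uv (here uv′) = cone-disjoint (≢-sym c≢a) (≢-sym a≢b) uv uv′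
    fresh-ab uv (there uv′) = old-fresh edge₁ uv uv′
    fresh-bc : ∀ {u v} → HasDir (cone b c) u v → ¬ Adj (cone a b ∷ cone c a ∷ map shift G) u v
    fresh-bc uv (here uv′) = cone-disjoint (≢-sym a≢b) (≢-sym b≢c) uv uv′
    fresh-bc uv (there (here uv′)) = cone-disjoint b≢c c≢a uv uv′
    fresh-bc uv (there (there uv′)) = old-fresh edge₂ uv uv′

  data Corner : Fin n → Set where
    corner-a : Corner a
    corner-b : Corner b
    corner-c : Corner c

  data Edge′ : Fin (suc n) → Fin (suc n) → Set where
    spoke-out : ∀ {x} → Corner x → Edge′ zero (suc x)
    spoke-in  : ∀ {x} → Corner x → Edge′ (suc x) zero
    old       : ∀ {x y} → Adj F x y → Edge′ (suc x) (suc y)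

  classify : ∀ {u v} → Adj F′ u v → Edge′ u v
  classify (here edge₁)                 = spoke-out corner-b
  classify (here edge₂)                 = old (here edge₂)
  classify (here edge₃)                 = spoke-in corner-c
  classify (there (here edge₁))         = spoke-out corner-a
  classify (there (here edge₂))         = old (here edge₁)
  classify (there (here edge₃))         = spoke-in corner-b
  classify (there (there (here edge₁))) = spoke-out corner-c
  classify (there (there (here edge₂))) = old (here edge₃)
  classify (there (there (here edge₃))) = spoke-in corner-a
  classify (there (there (there uv))) with Adj-shift⁻ G uv
  ... | shifted xy = old (there xy)

  spoke-out-Adj : ∀ {x} → Corner x → Adj F′ zero (suc x)
  spoke-out-Adj corner-a = there (here edge₁)
  spoke-out-Adj corner-b = here edge₁
  spoke-out-Adj corner-c = there (there (here edge₁))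

  spoke-in-Adj : ∀ {x} → Corner x → Adj F′ (suc x) zero
  spoke-in-Adj corner-a = there (there (here edge₃))
  spoke-in-Adj corner-b = there (here edge₃)
  spoke-in-Adj corner-c = here edge₃

  lift-Adj : ∀ {x y} → Adj F x y → Adj F′ (suc x) (suc y)
  lift-Adj (here edge₁) = there (here edge₂)
  lift-Adj (here edge₂) = here edge₂
  lift-Adj (here edge₃) = there (there (here edge₂))
  lift-Adj (there xy)   = there (there (there (Adj-shift⁺ xy)))

  dirSym′ : ∀ u v → Adj F′ u v → Adj F′ v u
  dirSym′ u v uv with classify uv
  ... | spoke-out k = spoke-in-Adj k
  ... | spoke-in k  = spoke-out-Adj k
  ... | old xy      = lift-Adj (dirSym _ _ xy)

  lift-Star : ∀ {x y} → Star (Adj F) x y → Star (Adj F′) (suc x) (suc y)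
  lift-Star = gmap suc lift-Adj

  connected′ : ∀ u v → Star (Adj F′) u v
  connected′ zero    zero    = ε
  connected′ zero    (suc y) = spoke-out-Adj corner-b ◅ lift-Star (connected b y)
  connected′ (suc x) zero    = lift-Star (connected x b) ◅◅ (spoke-in-Adj corner-b ◅ ε)
  connected′ (suc x) (suc y) = lift-Star (connected x y)

  toHub : ∀ {x} → Corner x → Star (Next F′ zero) (suc x) (suc b)
  toHub corner-a = there (here (edge₁ , edge₂)) ◅ ε
  toHub corner-b = ε
  toHub corner-c = there (there (here (edge₁ , edge₂))) ◅ there (here (edge₁ , edge₂)) ◅ ε

  fromHub : ∀ {x} → Corner x → Star (Next F′ zero) (suc b) (suc x)
  fromHub corner-a = here (edge₁ , edge₂) ◅ there (there (here (edge₁ , edge₂))) ◅ ε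
  fromHub corner-b = ε
  fromHub corner-c = here (edge₁ , edge₂) ◅ ε

  record CornerLink (w : Fin n) : Set where
    field
      prev next : Fin n
      toPrev    : Adj F w prev
      toNext    : Adj F w next
      enter     : Next F′ (suc w) zero (suc prev)
      leave     : Next F′ (suc w) (suc next) zero

  cornerLink : ∀ {w} → Corner w → CornerLink w
  cornerLink corner-a = record
    { toPrev = dirSym c a (here edge₃) ; toNext = here edge₁
    ; enter = there (there (here (edge₃ , edge₁))) ; leave = there (here (edge₂ , edge₃)) }
  cornerLink corner-b = record
    { toPrev = dirSym a b (here edge₁) ; toNext = here edge₂
    ; enter = there (here (edge₃ , edge₁)) ; leave = here (edge₂ , edge₃) }
  cornerLink corner-c = record
    { toPrev = dirSym b c (here edge₂) ; toNext = here edge₃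
    ; enter = here (edge₃ , edge₁) ; leave = there (there (here (edge₂ , edge₃))) }

  around : ∀ {w} (k : Corner w) → let open CornerLink (cornerLink k) in
    Star (Next F′ (suc w)) (suc next) (suc prev)
  around k = leave ◅ enter ◅ ε
    where open CornerLink (cornerLink k)

  lift-face-Next : ∀ {w x y} → HasDir (a , b , c) w x → HasDir (a , b , c) x y →
    Star (Next F′ (suc w)) (suc x) (suc y)
  lift-face-Next edge₁ edge₂ = around corner-a
  lift-face-Next edge₂ edge₃ = around corner-b
  lift-face-Next edge₃ edge₁ = around corner-c
  lift-face-Next edge₁ (inj₁ (e , _))        = ⊥-elim (a≢b (sym e))
  lift-face-Next edge₁ (inj₂ (inj₂ (e , _))) = ⊥-elim (b≢c e)
  lift-face-Next edge₂ (inj₁ (e , _))        = ⊥-elim (c≢a e)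
  lift-face-Next edge₂ (inj₂ (inj₁ (e , _))) = ⊥-elim (b≢c (sym e))
  lift-face-Next edge₃ (inj₂ (inj₁ (e , _))) = ⊥-elim (a≢b e)
  lift-face-Next edge₃ (inj₂ (inj₂ (e , _))) = ⊥-elim (c≢a (sym e))

  lift-Next : ∀ {w x y} → Next F w x y → Star (Next F′ (suc w)) (suc x) (suc y)
  lift-Next (here (wx , xy)) = lift-face-Next wx xy
  lift-Next (there wxy)      = there (there (there (Next-shift⁺ wxy))) ◅ ε

  lift-Link : ∀ {w x y} → Star (Next F w) x y → Star (Next F′ (suc w)) (suc x) (suc y)
  lift-Link = kleisliStar suc lift-Next

  linkCycle′ : ∀ v x y → Adj F′ v x → Adj F′ v y → Star (Next F′ v) x y
  linkCycle′ zero _ _ vx vy with classify vx | classify vy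
  ... | spoke-out k | spoke-out k′ = toHub k ◅◅ fromHub k′
  linkCycle′ (suc w) _ _ vx vy with classify vx | classify vy
  ... | old wx     | old wy     = lift-Link (linkCycle w _ _ wx wy)
  ... | spoke-in k | old wy     = let open CornerLink (cornerLink k) in
                                  enter ◅ lift-Link (linkCycle w prev _ toPrev wy)
  ... | old wx     | spoke-in k = let open CornerLink (cornerLink k) in
                                  lift-Link (linkCycle w _ next wx toNext) ◅◅ (leave ◅ ε)
  ... | spoke-in _ | spoke-in _ = ε

  isSurface : IsSurface (suc n) F′
  isSurface = record
    { faceDistinct = faceDistinct′ ; dirUnique = dirUnique′ ; dirSym = dirSym′
    ; linkCycle = linkCycle′ ; connected = connected′ }

module _ {A : Set} {R : A → A → Set} where

  Linked⇒Star-head : ∀ {x xs y} → Linked R (x ∷ xs) → y ∈ x ∷ xs → Star R x y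
  Linked⇒Star-head _        (here refl) = ε
  Linked⇒Star-head (r ∷ rs) (there y∈)  = r ◅ Linked⇒Star-head rs y∈

  Linked⇒Star-last : ∀ xs {y z} → Linked R (xs ∷ʳ z) → y ∈ xs ∷ʳ z → Star R y z
  Linked⇒Star-last []           _        (here refl) = ε
  Linked⇒Star-last (_ ∷ [])     (r ∷ _)  (here refl) = r ◅ ε
  Linked⇒Star-last (_ ∷ x ∷ xs) (r ∷ rs) (here refl) = r ◅ Linked⇒Star-last (x ∷ xs) rs (here refl)
  Linked⇒Star-last (_ ∷ xs)     rs       (there y∈)  = Linked⇒Star-last xs (Linked.tail rs) y∈

  closedWalk-Star : ∀ {x xs y y′} → Linked R (x ∷ xs ∷ʳ x) →
    y ∈ x ∷ xs ∷ʳ x → y′ ∈ x ∷ xs ∷ʳ x → Star R y y′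
  closedWalk-Star {x} {xs} walk y∈ y′∈ =
    Linked⇒Star-last (x ∷ xs) walk y∈ ◅◅ Linked⇒Star-head walk y′∈

-- Double counting of edges

sumᶻ : List ℤ → ℤ
sumᶻ = foldr _+_ (+ 0)

sumᶻ-++ : ∀ xs ys → sumᶻ (xs ++ ys) ≡ sumᶻ xs + sumᶻ ys
sumᶻ-++ []       ys = sym (ℤP.+-identityˡ _)
sumᶻ-++ (x ∷ xs) ys = trans (cong (_+_ x) (sumᶻ-++ xs ys)) (sym (ℤP.+-assoc x _ _))

sumᶻ-const : ∀ {A : Set} k (xs : List A) → sumᶻ (map (λ _ → k) xs) ≡ k * + length xs
sumᶻ-const k []       = sym (ℤP.*-zeroʳ k)
sumᶻ-const k (_ ∷ xs) = trans (cong (_+_ k) (sumᶻ-const k xs)) (step k (+ length xs))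
  where
  step : ∀ k l → k + k * l ≡ k * (+ 1 + l)
  step = solve-∀

sumᶻ-filter : ∀ {A : Set} {P : A → Set} (P? : ∀ x → Dec (P x)) (h : A → ℤ) xs →
  sumᶻ (map h (filter P? xs)) ≡ sumᶻ (map (λ x → if does (P? x) then h x else + 0) xs)
sumᶻ-filter P? h []       = refl
sumᶻ-filter P? h (x ∷ xs) with does (P? x)
... | true  = cong (_+_ (h x)) (sumᶻ-filter P? h xs)
... | false = trans (sumᶻ-filter P? h xs) (sym (ℤP.+-identityˡ _))

sumᶻ-cartesianProduct : ∀ {A B : Set} (k : A × B → ℤ) xs (ys : List B) →
  sumᶻ (map k (cartesianProduct xs ys)) ≡ sumᶻ (map (λ x → sumᶻ (map (λ y → k (x , y)) ys)) xs)
sumᶻ-cartesianProduct k []       ys = refl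
sumᶻ-cartesianProduct k (x ∷ xs) ys = begin
  sumᶻ (map k (map (x ,_) ys ++ cartesianProduct xs ys))
    ≡⟨ cong sumᶻ (ListP.map-++ k (map (x ,_) ys) _) ⟩
  sumᶻ (map k (map (x ,_) ys) ++ map k (cartesianProduct xs ys))
    ≡⟨ sumᶻ-++ (map k (map (x ,_) ys)) _ ⟩
  sumᶻ (map k (map (x ,_) ys)) + sumᶻ (map k (cartesianProduct xs ys))
    ≡⟨ cong₂ _+_ (cong sumᶻ (sym (ListP.map-∘ ys))) (sumᶻ-cartesianProduct k xs ys) ⟩
  sumᶻ (map (λ y → k (x , y)) ys) + sumᶻ (map (λ x → sumᶻ (map (λ y → k (x , y)) ys)) xs) ∎
  where open ≡-Reasoning

sumᶻ-tabulate : ∀ {n} (f : Fin n → ℤ) → sumᶻ (tabulate f) ≡ ∑[ i < n ] f i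
sumᶻ-tabulate {zero}  f = refl
sumᶻ-tabulate {suc n} f = cong (_+_ (f zero)) (sumᶻ-tabulate (f ∘ suc))

sumᶻ-allFin : ∀ n (f : Fin n → ℤ) → sumᶻ (map f (allFin n)) ≡ ∑[ i < n ] f i
sumᶻ-allFin n f = trans (cong sumᶻ (ListP.map-tabulate (λ i → i) f)) (sumᶻ-tabulate f)

∑-sumᶻ : ∀ {n} {A : Set} (k : A → Fin n → ℤ) (xs : List A) →
  ∑[ i < n ] sumᶻ (map (λ x → k x i) xs) ≡ sumᶻ (map (λ x → ∑[ i < n ] k x i) xs)
∑-sumᶻ {n} k []       = sum-replicate-zero n
∑-sumᶻ {n} k (x ∷ xs) = trans (∑-distrib-+ (k x) _) (cong (_+_ (∑[ i < n ] k x i)) (∑-sumᶻ k xs))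

∑-point : ∀ {n} (x : Fin n) (h : Fin n → ℤ) → ∑[ u < n ] (if does (u ≟ x) then h u else + 0) ≡ h x
∑-point {suc n} zero    h = trans (cong (_+_ (h zero)) (sum-replicate-zero n)) (ℤP.+-identityʳ _)
∑-point         (suc x) h = trans (ℤP.+-identityˡ _) (∑-point x (h ∘ suc))

if-∧ : ∀ p q (z : ℤ) → (if p ∧ q then z else + 0) ≡ (if p then (if q then z else + 0) else + 0)
if-∧ true  q z = refl
if-∧ false q z = refl

if-∨₃ : ∀ p q r (z : ℤ) → p ∧ q ≡ false → q ∧ r ≡ false → p ∧ r ≡ false →
  (if p ∨ q ∨ r then z else + 0) ≡
  (if p then z else + 0) + ((if q then z else + 0) + (if r then z else + 0))
if-∨₃ true  true  _     _ () _  _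
if-∨₃ true  false true  _ _  _  ()
if-∨₃ false true  true  _ _  () _
if-∨₃ true  false false z _  _  _ = sym (ℤP.+-identityʳ z)
if-∨₃ false true  false z _  _  _ = sym (trans (ℤP.+-identityˡ _) (ℤP.+-identityʳ z))
if-∨₃ false false r     z _  _  _ = sym (trans (ℤP.+-identityˡ _) (ℤP.+-identityˡ _))

∧-disjoint : ∀ p q r s → p ∧ r ≡ false → (p ∧ q) ∧ (r ∧ s) ≡ false
∧-disjoint true  q true  s ()
∧-disjoint true  true  false s _ = refl
∧-disjoint true  false false s _ = refl
∧-disjoint false q r     s _ = refl

≟-disjoint : ∀ {n} {x y : Fin n} → x ≢ y → ∀ u → does (u ≟ x) ∧ does (u ≟ y) ≡ false
≟-disjoint {x = x} {y} x≢y u with u ≟ x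
... | yes refl = dec-false (u ≟ y) x≢y
... | no _     = refl

if-any : ∀ {A : Set} {P : A → Set} (P? : ∀ x → Dec (P x)) (z : ℤ) xs →
  length (filter P? xs) ℕ.≤ 1 →
  (if does (any? P? xs) then z else + 0) ≡ sumᶻ (map (λ x → if does (P? x) then z else + 0) xs)
if-any P? z []       _ = refl
if-any P? z (x ∷ xs) c with P? x
... | yes _ = begin
  z
    ≡⟨ sym (ℤP.+-identityʳ z) ⟩
  z + + 0
    ≡⟨ cong (_+_ z) (sym (sumᶻ-none xs (ℕP.n≤0⇒n≡0 (ℕP.≤-pred c)))) ⟩
  z + sumᶻ (map (λ x → if does (P? x) then z else + 0) xs) ∎
  where
  open ≡-Reasoning
  sumᶻ-none : ∀ xs → length (filter P? xs) ≡ 0 →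
    sumᶻ (map (λ x → if does (P? x) then z else + 0) xs) ≡ + 0
  sumᶻ-none []       _ = refl
  sumᶻ-none (x ∷ xs) e with P? x
  ... | yes _ = ⊥-elim (ℕP.0≢1+n (sym e))
  ... | no _  = trans (ℤP.+-identityˡ _) (sumᶻ-none xs e)
... | no _ = trans (if-any P? z xs c) (sym (ℤP.+-identityˡ _))

edgeSum : ∀ {n} → List (Face n) → (Fin n → Fin n → ℤ) → ℤ
edgeSum F g = sumᶻ (map (λ p → g (proj₁ p) (proj₂ p)) (edgeList F))

boundarySum : ∀ {n} → (Fin n → Fin n → ℤ) → Face n → ℤ
boundarySum g (a , b , c) = g a b + (g b c + g c a)

Adj-irrefl : ∀ {n} {F : List (Face n)} → All FaceDistinct F → ∀ {u} → ¬ Adj F u u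
Adj-irrefl ((a≢b , _ , _) ∷ _) (here (inj₁ (refl , e)))        = a≢b e
Adj-irrefl ((_ , b≢c , _) ∷ _) (here (inj₂ (inj₁ (refl , e)))) = b≢c e
Adj-irrefl ((_ , _ , c≢a) ∷ _) (here (inj₂ (inj₂ (refl , e)))) = c≢a e
Adj-irrefl (_ ∷ distinct)      (there uu)                       = Adj-irrefl distinct uu

∑∑-distrib-+ : ∀ {n} (X Y : Fin n → Fin n → ℤ) →
  ∑[ u < n ] ∑[ v < n ] (X u v + Y u v) ≡ ∑[ u < n ] ∑[ v < n ] X u v + ∑[ u < n ] ∑[ v < n ] Y u v
∑∑-distrib-+ {n} X Y =
  trans (sum-cong-≗ (λ u → ∑-distrib-+ (X u) (Y u)))
        (∑-distrib-+ (λ u → ∑[ v < n ] X u v) (λ u → ∑[ v < n ] Y u v))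

∑∑-cong : ∀ {n} {X Y : Fin n → Fin n → ℤ} → (∀ u v → X u v ≡ Y u v) →
  ∑[ u < n ] ∑[ v < n ] X u v ≡ ∑[ u < n ] ∑[ v < n ] Y u v
∑∑-cong X≡Y = sum-cong-≗ (λ u → sum-cong-≗ (X≡Y u))

∑∑-point : ∀ {n} (x y : Fin n) (g : Fin n → Fin n → ℤ) →
  ∑[ u < n ] ∑[ v < n ] (if does (u ≟ x) ∧ does (v ≟ y) then g u v else + 0) ≡ g x y
∑∑-point {n} x y g = begin
  ∑[ u < n ] ∑[ v < n ] (if does (u ≟ x) ∧ does (v ≟ y) then g u v else + 0)
    ≡⟨ ∑∑-cong (λ u v → if-∧ (does (u ≟ x)) (does (v ≟ y)) (g u v)) ⟩
  ∑[ u < n ] ∑[ v < n ] (if does (u ≟ x) then (if does (v ≟ y) then g u v else + 0) else + 0)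
    ≡⟨ sum-cong-≗ (λ u → ∑-if (does (u ≟ x)) (λ v → if does (v ≟ y) then g u v else + 0)) ⟩
  ∑[ u < n ] (if does (u ≟ x) then ∑[ v < n ] (if does (v ≟ y) then g u v else + 0) else + 0)
    ≡⟨ ∑-point x (λ u → ∑[ v < n ] (if does (v ≟ y) then g u v else + 0)) ⟩
  ∑[ v < n ] (if does (v ≟ y) then g x v else + 0)
    ≡⟨ ∑-point y (g x) ⟩
  g x y ∎
  where
  open ≡-Reasoning
  ∑-if : ∀ p (h : Fin n → ℤ) → ∑[ v < n ] (if p then h v else + 0) ≡ (if p then ∑[ v < n ] h v else + 0)
  ∑-if true  h = refl
  ∑-if false h = sum-replicate-zero n

∑∑-HasDir : ∀ {n} (g : Fin n → Fin n → ℤ) (f : Face n) → FaceDistinct f →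
  ∑[ u < n ] ∑[ v < n ] (if does (hasDir? f u v) then g u v else + 0) ≡ boundarySum g f
∑∑-HasDir {n} g (a , b , c) (a≢b , b≢c , c≢a) = begin
  ∑[ u < n ] ∑[ v < n ] (if does (hasDir? (a , b , c) u v) then g u v else + 0)
    ≡⟨ ∑∑-cong (λ u v → if-∨₃ (at a b u v) (at b c u v) (at c a u v) (g u v)
         (∧-disjoint (does (u ≟ a)) _ (does (u ≟ b)) _ (≟-disjoint a≢b u))
         (∧-disjoint (does (u ≟ b)) _ (does (u ≟ c)) _ (≟-disjoint b≢c u))
         (∧-disjoint (does (u ≟ a)) _ (does (u ≟ c)) _ (≟-disjoint (≢-sym c≢a) u))) ⟩
  ∑[ u < n ] ∑[ v < n ] (δ a b u v + (δ b c u v + δ c a u v))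
    ≡⟨ ∑∑-distrib-+ (δ a b) _ ⟩
  ∑[ u < n ] ∑[ v < n ] δ a b u v + ∑[ u < n ] ∑[ v < n ] (δ b c u v + δ c a u v)
    ≡⟨ cong (_+_ (∑[ u < n ] ∑[ v < n ] δ a b u v)) (∑∑-distrib-+ (δ b c) (δ c a)) ⟩
  ∑[ u < n ] ∑[ v < n ] δ a b u v + (∑[ u < n ] ∑[ v < n ] δ b c u v + ∑[ u < n ] ∑[ v < n ] δ c a u v)
    ≡⟨ cong₂ _+_ (∑∑-point a b g) (cong₂ _+_ (∑∑-point b c g) (∑∑-point c a g)) ⟩
  g a b + (g b c + g c a) ∎
  where
  open ≡-Reasoning
  at : Fin n → Fin n → Fin n → Fin n → Bool
  at x y u v = does (u ≟ x) ∧ does (v ≟ y)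
  δ : Fin n → Fin n → Fin n → Fin n → ℤ
  δ x y u v = if at x y u v then g u v else + 0

module DoubleCounting {n} {F : List (Face n)}
  (faceDistinct : All FaceDistinct F) (dirUnique : DirUnique F)
  (dirSym : ∀ u v → Adj F u v → Adj F v u) where

  adj?-sym : ∀ u v → does (adj? F u v) ≡ does (adj? F v u)
  adj?-sym u v with adj? F u v | adj? F v u
  ... | yes _  | yes _  = refl
  ... | no _   | no _   = refl
  ... | yes uv | no ¬vu = ⊥-elim (¬vu (dirSym u v uv))
  ... | no ¬uv | yes vu = ⊥-elim (¬uv (dirSym v u vu))

  module _ (g : Fin n → Fin n → ℤ) (g-sym : ∀ u v → g u v ≡ g v u) where

    upper : Fin n → Fin n → ℤ
    upper u v = if does (toℕ u ℕ.<? toℕ v) ∧ does (adj? F u v) then g u v else + 0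

    adjacent : Fin n → Fin n → ℤ
    adjacent u v = if does (adj? F u v) then g u v else + 0

    edgeSum-upper : edgeSum F g ≡ ∑[ u < n ] ∑[ v < n ] upper u v
    edgeSum-upper = begin
      edgeSum F g
        ≡⟨ sumᶻ-filter (λ p → (toℕ (proj₁ p) ℕ.<? toℕ (proj₂ p)) ×-dec adj? F (proj₁ p) (proj₂ p))
                       (λ p → g (proj₁ p) (proj₂ p)) (cartesianProduct (allFin n) (allFin n)) ⟩
      sumᶻ (map (λ p → upper (proj₁ p) (proj₂ p)) (cartesianProduct (allFin n) (allFin n)))
        ≡⟨ sumᶻ-cartesianProduct (λ p → upper (proj₁ p) (proj₂ p)) (allFin n) (allFin n) ⟩
      sumᶻ (map (λ u → sumᶻ (map (upper u) (allFin n))) (allFin n))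
        ≡⟨ cong sumᶻ (ListP.map-cong (λ u → sumᶻ-allFin n (upper u)) (allFin n)) ⟩
      sumᶻ (map (λ u → ∑[ v < n ] upper u v) (allFin n))
        ≡⟨ sumᶻ-allFin n (λ u → ∑[ v < n ] upper u v) ⟩
      ∑[ u < n ] ∑[ v < n ] upper u v ∎
      where open ≡-Reasoning

    upper-sym : ∀ u v → upper u v + upper v u ≡ adjacent u v
    upper-sym u v with ℕP.<-cmp (toℕ u) (toℕ v)
    ... | tri< u<v _ v≮u
      rewrite dec-true (toℕ u ℕ.<? toℕ v) u<v | dec-false (toℕ v ℕ.<? toℕ u) v≮u = ℤP.+-identityʳ _
    ... | tri> u≮v _ v<u
      rewrite dec-false (toℕ u ℕ.<? toℕ v) u≮v | dec-true (toℕ v ℕ.<? toℕ u) v<u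
            | adj?-sym v u | g-sym v u = ℤP.+-identityˡ _
    ... | tri≈ u≮v u≡v _ with FinP.toℕ-injective u≡v
    ...   | refl rewrite dec-false (toℕ u ℕ.<? toℕ u) u≮v
                       | dec-false (adj? F u u) (Adj-irrefl faceDistinct) = refl

    twice-edgeSum : + 2 * edgeSum F g ≡ ∑[ u < n ] ∑[ v < n ] adjacent u v
    twice-edgeSum = begin
      + 2 * edgeSum F g
        ≡⟨ two (edgeSum F g) ⟩
      edgeSum F g + edgeSum F g
        ≡⟨ cong₂ _+_ edgeSum-upper (trans edgeSum-upper (∑-comm upper)) ⟩
      ∑[ u < n ] ∑[ v < n ] upper u v + ∑[ u < n ] ∑[ v < n ] upper v u
        ≡⟨ sym (∑∑-distrib-+ upper (λ u v → upper v u)) ⟩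
      ∑[ u < n ] ∑[ v < n ] (upper u v + upper v u)
        ≡⟨ ∑∑-cong upper-sym ⟩
      ∑[ u < n ] ∑[ v < n ] adjacent u v ∎
      where
      open ≡-Reasoning
      two : ∀ x → + 2 * x ≡ x + x
      two = solve-∀

    double-counting : + 2 * edgeSum F g ≡ sumᶻ (map (boundarySum g) F)
    double-counting = begin
      + 2 * edgeSum F g
        ≡⟨ twice-edgeSum ⟩
      ∑[ u < n ] ∑[ v < n ] adjacent u v
        ≡⟨ ∑∑-cong (λ u v → if-any (λ f → hasDir? f u v) (g u v) F (dirUnique u v)) ⟩
      ∑[ u < n ] ∑[ v < n ] sumᶻ (map (λ f → directed f u v) F)
        ≡⟨ sum-cong-≗ (λ u → ∑-sumᶻ (λ f v → directed f u v) F) ⟩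
      ∑[ u < n ] sumᶻ (map (λ f → ∑[ v < n ] directed f u v) F)
        ≡⟨ ∑-sumᶻ (λ f u → ∑[ v < n ] directed f u v) F ⟩
      sumᶻ (map (λ f → ∑[ u < n ] ∑[ v < n ] directed f u v) F)
        ≡⟨ cong sumᶻ (ListP.map-cong-local (All.map (λ {f} → ∑∑-HasDir g f) faceDistinct)) ⟩
      sumᶻ (map (boundarySum g) F) ∎
      where
      open ≡-Reasoning
      directed : Face n → Fin n → Fin n → ℤ
      directed f u v = if does (hasDir? f u v) then g u v else + 0

euler-characteristic : ∀ {n} {F : List (Face n)} → IsSurface n F → length F ≡ 2 ℕ.* n →
  (+ n - + length (edgeList F)) + + length F ≡ + 0
euler-characteristic {n} {F} surface |F|≡2n = begin
  (+ n - + E) + + length F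
    ≡⟨ cong₂ (λ e f → (+ n - e) + f) E≡3n |F|≡2n′ ⟩
  (+ n - + 3 * + n) + + 2 * + n
    ≡⟨ vanishes (+ n) ⟩
  + 0 ∎
  where
  open ≡-Reasoning
  open IsSurface surface
  open DoubleCounting faceDistinct dirUnique dirSym
  E : ℕ
  E = length (edgeList F)
  |F|≡2n′ : + length F ≡ + 2 * + n
  |F|≡2n′ = trans (cong +_ |F|≡2n) (ℤP.pos-* 2 n)
  vanishes : ∀ x → (x - + 3 * x) + + 2 * x ≡ + 0
  vanishes = solve-∀
  reorder : ∀ x → + 3 * (+ 2 * x) ≡ + 2 * (+ 3 * x)
  reorder = solve-∀
  E≡3n : + E ≡ + 3 * + n
  E≡3n = ℤP.*-cancelˡ-≡ (+ 2) (+ E) (+ 3 * + n) (begin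
    + 2 * + E                        ≡⟨ cong (+ 2 *_) (sym (ℤP.*-identityˡ (+ E))) ⟩
    + 2 * (+ 1 * + E)                ≡⟨ cong (+ 2 *_) (sym (sumᶻ-const (+ 1) (edgeList F))) ⟩
    + 2 * edgeSum F (λ _ _ → + 1)    ≡⟨ double-counting (λ _ _ → + 1) (λ _ _ → refl) ⟩
    sumᶻ (map (λ _ → + 3) F)         ≡⟨ sumᶻ-const (+ 3) F ⟩
    + 3 * + length F                 ≡⟨ cong (+ 3 *_) |F|≡2n′ ⟩
    + 3 * (+ 2 * + n)                ≡⟨ reorder (+ n) ⟩
    + 2 * (+ 3 * + n)                ∎)

-- Energy and monochromatic faces

excess : Sign → Sign → Sign → ℕ
excess Sign.+ Sign.+ Sign.+ = 4
excess Sign.- Sign.- Sign.- = 4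
excess _      _      _      = 0

spin-excess : ∀ x y z →
  (spin x * spin y + (spin y * spin z + spin z * spin x)) + + 1 ≡ + excess x y z
spin-excess Sign.+ Sign.+ Sign.+ = refl
spin-excess Sign.+ Sign.+ Sign.- = refl
spin-excess Sign.+ Sign.- Sign.+ = refl
spin-excess Sign.+ Sign.- Sign.- = refl
spin-excess Sign.- Sign.+ Sign.+ = refl
spin-excess Sign.- Sign.+ Sign.- = refl
spin-excess Sign.- Sign.- Sign.+ = refl
spin-excess Sign.- Sign.- Sign.- = refl

faceExcess : ∀ {n} → (Fin n → Sign) → Face n → ℕ
faceExcess σ (a , b , c) = excess (σ a) (σ b) (σ c)

NoMonochromaticFace : ∀ {n} → (Fin n → Sign) → List (Face n) → Set
NoMonochromaticFace σ F = All (λ f → faceExcess σ f ≡ 0) F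

sum≡0⇒All : ∀ {A : Set} (f : A → ℕ) xs → sum (map f xs) ≡ 0 → All (λ x → f x ≡ 0) xs
sum≡0⇒All f []       _ = []
sum≡0⇒All f (x ∷ xs) e = ℕP.m+n≡0⇒m≡0 (f x) e ∷ sum≡0⇒All f xs (ℕP.m+n≡0⇒n≡0 (f x) e)

All⇒sum≡0 : ∀ {A : Set} (f : A → ℕ) {xs} → All (λ x → f x ≡ 0) xs → sum (map f xs) ≡ 0
All⇒sum≡0 f []         = refl
All⇒sum≡0 f (fx≡0 ∷ p) = cong₂ ℕ._+_ fx≡0 (All⇒sum≡0 f p)

coupling : ∀ {n} → (Fin n → Sign) → Fin n → Fin n → ℤ
coupling σ u v = spin (σ u) * spin (σ v)

boundary-excess : ∀ {n} (σ : Fin n → Sign) G →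
  sumᶻ (map (boundarySum (coupling σ)) G) + + length G ≡ + sum (map (faceExcess σ) G)
boundary-excess σ []              = refl
boundary-excess σ ((a , b , c) ∷ G) = begin
  (s + rest) + (+ 1 + + length G)  ≡⟨ interchange s rest (+ 1) (+ length G) ⟩
  (s + + 1) + (rest + + length G)  ≡⟨ cong₂ _+_ (spin-excess (σ a) (σ b) (σ c)) (boundary-excess σ G) ⟩
  + excess (σ a) (σ b) (σ c) + + sum (map (faceExcess σ) G) ∎
  where
  open ≡-Reasoning
  s rest : ℤ
  s = boundarySum (coupling σ) (a , b , c)
  rest = sumᶻ (map (boundarySum (coupling σ)) G)
  interchange : ∀ w x y z → (w + x) + (y + z) ≡ (w + y) + (x + z)
  interchange = solve-∀

+-cancelʳ-≤ : ∀ k {i j} → i + k ℤ.≤ j + k → i ℤ.≤ j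
+-cancelʳ-≤ k {i} {j} i+k≤j+k =
  subst₂ ℤ._≤_ (cancel i k) (cancel j k) (ℤP.+-monoˡ-≤ (ℤ.- k) i+k≤j+k)
  where
  cancel : ∀ x y → (x + y) + ℤ.- y ≡ x
  cancel = solve-∀

module Groundstates (T : TorusTriangulation) where
  open IsTorusTriangulation (isTorus T)

  F : List (Face (nV T))
  F = faces T

  energy-excess : ∀ σ → + 2 * energy T σ + + length F ≡ + sum (map (faceExcess σ) F)
  energy-excess σ =
    trans (cong (_+ + length F)
                (DoubleCounting.double-counting faceDistinct dirUnique dirSym
                   (coupling σ) (λ u v → ℤP.*-comm (spin (σ u)) (spin (σ v)))))
          (boundary-excess σ F)

  noMonochromaticFace⇒groundstate : ∀ σ → NoMonochromaticFace σ F → Groundstate T σ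
  noMonochromaticFace⇒groundstate σ σ-ok τ =
    ℤP.*-cancelˡ-≤-pos (energy T σ) (energy T τ) (+ 2)
      (+-cancelʳ-≤ (+ length F)
        (subst₂ ℤ._≤_ (sym (trans (energy-excess σ) (cong +_ (All⇒sum≡0 (faceExcess σ) σ-ok))))
                      (sym (energy-excess τ)) (+≤+ z≤n)))

  groundstate⇒noMonochromaticFace : ∀ σ → NoMonochromaticFace σ F →
    ∀ τ → Groundstate T τ → NoMonochromaticFace τ F
  groundstate⇒noMonochromaticFace σ σ-ok τ τ-ground =
    sum≡0⇒All (faceExcess τ) F (ℕP.n≤0⇒n≡0 (ℤP.drop‿+≤+
      (subst₂ ℤ._≤_ (energy-excess τ) (trans (energy-excess σ) (cong +_ (All⇒sum≡0 (faceExcess σ) σ-ok)))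
        (ℤP.+-monoˡ-≤ (+ length F) (ℤP.*-monoˡ-≤-nonNeg (+ 2) (τ-ground σ))))))

infix 4 _≈±_
_≈±_ : ∀ {n} → (Fin n → Sign) → (Fin n → Sign) → Set
τ ≈± σ = (∀ v → τ v ≡ σ v) ⊎ (∀ v → τ v ≡ opposite (σ v))

≈±? : ∀ {n} (τ σ : Fin n → Sign) → Dec (τ ≈± σ)
≈±? τ σ = FinP.all? (λ v → τ v SignP.≟ σ v) ⊎-dec FinP.all? (λ v → τ v SignP.≟ opposite (σ v))

≈±-respˡ : ∀ {n} {σ τ ρ : Fin n → Sign} → σ ≗ τ → σ ≈± ρ → τ ≈± ρ
≈±-respˡ σ≗τ (inj₁ σ≡ρ)  = inj₁ (λ v → trans (sym (σ≗τ v)) (σ≡ρ v))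
≈±-respˡ σ≗τ (inj₂ σ≡-ρ) = inj₂ (λ v → trans (sym (σ≗τ v)) (σ≡-ρ v))

≈±-≢ : ∀ {n} {τ σ : Fin n → Sign} → τ ≈± σ → ∀ {x y} → σ x ≢ σ y → τ x ≢ τ y
≈±-≢ (inj₁ τ≡σ)  σx≢σy τx≡τy = σx≢σy (trans (sym (τ≡σ _)) (trans τx≡τy (τ≡σ _)))
≈±-≢ (inj₂ τ≡-σ) σx≢σy τx≡τy =
  σx≢σy (SignP.opposite-injective (trans (sym (τ≡-σ _)) (trans τx≡τy (τ≡-σ _))))

≈±-◂ : ∀ {n} {τ : Fin (suc n) → Sign} {σ : Fin n → Sign} {a} →
  τ ∘ suc ≈± σ → τ zero ≡ opposite (τ (suc a)) → τ ≈± opposite (σ a) ◂ σ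
≈±-◂ {a = a} (inj₁ τ≡σ) τ₀ = inj₁ λ where
  zero    → trans τ₀ (cong opposite (τ≡σ a))
  (suc v) → τ≡σ v
≈±-◂ {a = a} (inj₂ τ≡-σ) τ₀ = inj₂ λ where
  zero    → trans τ₀ (cong opposite (τ≡-σ a))
  (suc v) → τ≡-σ v

allSigns? : ∀ {P : Sign → Set} → (∀ s → Dec (P s)) → Dec (∀ s → P s)
allSigns? P? = map′ (λ (p₊ , p₋) → λ { Sign.+ → p₊ ; Sign.- → p₋ })
                    (λ ∀p → ∀p Sign.+ , ∀p Sign.-)
                    (P? Sign.+ ×-dec P? Sign.-)

allStates? : ∀ {n} {P : (Fin n → Sign) → Set} → (∀ {σ τ} → σ ≗ τ → P σ → P τ) →
  (∀ σ → Dec (P σ)) → Dec (∀ σ → P σ)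
allStates? {zero} resp P? = map′ (λ p σ → resp (λ ()) p) (λ ∀p → ∀p none) (P? none)
  where
  none : Fin 0 → Sign
  none ()
allStates? {suc n} resp P? =
  map′ (λ ∀p σ → resp (λ { zero → refl ; (suc _) → refl }) (∀p (σ zero) (σ ∘ suc)))
       (λ ∀p s σ → ∀p (s ◂ σ))
       (allSigns? λ s → allStates? (λ σ≗τ → resp (λ { zero → refl ; (suc i) → σ≗τ i }))
                                   (λ σ → P? (s ◂ σ)))

faceExcess-cong : ∀ {n} {σ τ : Fin n → Sign} → σ ≗ τ → ∀ f → faceExcess σ f ≡ faceExcess τ f
faceExcess-cong σ≗τ (a , b , c) rewrite σ≗τ a | σ≗τ b | σ≗τ c = refl

noMonochromaticFace? : ∀ {n} (σ : Fin n → Sign) G → Dec (NoMonochromaticFace σ G)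
noMonochromaticFace? σ = All.all? (λ f → faceExcess σ f ℕ.≟ 0)

excess-forces-opposite : ∀ x p q r → excess x p q ≡ 0 → excess x r p ≡ 0 → q ≢ r → x ≡ opposite p
excess-forces-opposite Sign.+ Sign.- _      _      _  _  _   = refl
excess-forces-opposite Sign.- Sign.+ _      _      _  _  _   = refl
excess-forces-opposite Sign.+ Sign.+ Sign.+ _      () _  _
excess-forces-opposite Sign.+ Sign.+ Sign.- Sign.+ _  () _
excess-forces-opposite Sign.+ Sign.+ Sign.- Sign.- _  _  q≢r = ⊥-elim (q≢r refl)
excess-forces-opposite Sign.- Sign.- Sign.- _      () _  _
excess-forces-opposite Sign.- Sign.- Sign.+ Sign.- _  () _
excess-forces-opposite Sign.- Sign.- Sign.+ Sign.+ _  _  q≢r = ⊥-elim (q≢r refl)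

excess-+- : ∀ x → excess x Sign.+ Sign.- ≡ 0
excess-+- Sign.+ = refl
excess-+- Sign.- = refl

excess-opposite₁ : ∀ x y → excess (opposite x) x y ≡ 0
excess-opposite₁ Sign.+ _ = refl
excess-opposite₁ Sign.- _ = refl

excess-opposite₂ : ∀ x y → excess (opposite x) y x ≡ 0
excess-opposite₂ Sign.+ Sign.+ = refl
excess-opposite₂ Sign.+ Sign.- = refl
excess-opposite₂ Sign.- Sign.+ = refl
excess-opposite₂ Sign.- Sign.- = refl

-- The torus K₃ + C₆

next? : ∀ {n} (F : List (Face n)) v x y → Dec (Next F v x y)
next? F v x y = any? (λ f → hasDir? f v x ×-dec hasDir? f x y) F

faceDistinct? : ∀ {n} (f : Face n) → Dec (FaceDistinct f)
faceDistinct? (a , b , c) = ¬? (a ≟ b) ×-dec ¬? (b ≟ c) ×-dec ¬? (c ≟ a)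

-- The triangle is 0 1 2 and the hexagon 3 6 4 7 5 8.
torus₉ : List⁺ (Face 9)
torus₉ = (6F , 1F , 3F) ∷
  (0F , 3F , 1F) ∷ (1F , 4F , 2F) ∷ (4F , 7F , 2F) ∷ (2F , 5F , 0F) ∷ (5F , 8F , 0F) ∷
  (4F , 1F , 6F) ∷ (6F , 0F , 4F) ∷ (5F , 2F , 7F) ∷ (7F , 1F , 5F) ∷ (3F , 0F , 8F) ∷
  (8F , 2F , 3F) ∷ (7F , 4F , 0F) ∷ (0F , 1F , 7F) ∷ (8F , 5F , 1F) ∷ (1F , 2F , 8F) ∷
  (6F , 3F , 2F) ∷ (2F , 0F , 6F) ∷ []

module Torus₉ where

  F : List (Face 9)
  F = toList torus₉

  rotation : Fin 9 → Fin 9 × List (Fin 9)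
  rotation 0F = 3F , 1F ∷ 7F ∷ 4F ∷ 6F ∷ 2F ∷ 5F ∷ 8F ∷ []
  rotation 1F = 0F , 3F ∷ 6F ∷ 4F ∷ 2F ∷ 8F ∷ 5F ∷ 7F ∷ []
  rotation 2F = 1F , 4F ∷ 7F ∷ 5F ∷ 0F ∷ 6F ∷ 3F ∷ 8F ∷ []
  rotation 3F = 1F , 0F ∷ 8F ∷ 2F ∷ 6F ∷ []
  rotation 4F = 2F , 1F ∷ 6F ∷ 0F ∷ 7F ∷ []
  rotation 5F = 0F , 2F ∷ 7F ∷ 1F ∷ 8F ∷ []
  rotation 6F = 1F , 3F ∷ 2F ∷ 0F ∷ 4F ∷ []
  rotation 7F = 2F , 4F ∷ 0F ∷ 1F ∷ 5F ∷ []
  rotation 8F = 0F , 5F ∷ 1F ∷ 2F ∷ 3F ∷ []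

  link : Fin 9 → List (Fin 9)
  link v = let (x , xs) = rotation v in x ∷ xs ∷ʳ x

  hamiltonPath : List (Fin 9)
  hamiltonPath = 3F ∷ 6F ∷ 4F ∷ 7F ∷ 5F ∷ 8F ∷ 0F ∷ 1F ∷ 2F ∷ []

  dirSym₉ : ∀ u v → Adj F u v → Adj F v u
  dirSym₉ = from-yes (FinP.all? λ u → FinP.all? λ v → adj? F u v →-dec adj? F v u)

  linkWalk : ∀ v → Linked (Next F v) (link v)
  linkWalk = from-yes (FinP.all? λ v → linked? (next? F v) (link v))

  link-complete : ∀ v x → Adj F v x → x ∈ link v
  link-complete = from-yes (FinP.all? λ v → FinP.all? λ x → adj? F v x →-dec x ∈? link v)

  hamiltonPath-Linked : Linked (Adj F) hamiltonPath
  hamiltonPath-Linked = from-yes (linked? (adj? F) hamiltonPath)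

  hamiltonPath-complete : ∀ v → v ∈ hamiltonPath
  hamiltonPath-complete = from-yes (FinP.all? (_∈? hamiltonPath))

  isSurface : IsSurface 9 F
  isSurface = record
    { faceDistinct = from-yes (All.all? faceDistinct? F)
    ; dirUnique    = from-yes (FinP.all? λ u → FinP.all? λ v → dirCount F u v ℕ.≤? 1)
    ; dirSym       = dirSym₉
    ; linkCycle    = λ v x y vx vy →
        closedWalk-Star (linkWalk v) (link-complete v x vx) (link-complete v y vy)
    ; connected    = λ u v →
        reverse (λ {x} {y} → dirSym₉ x y) (Linked⇒Star-head hamiltonPath-Linked (hamiltonPath-complete u))
          ◅◅ Linked⇒Star-head hamiltonPath-Linked (hamiltonPath-complete v)
    }

σ₉ : Fin 9 → Sign
σ₉ 0F = Sign.+
σ₉ 1F = Sign.+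
σ₉ 2F = Sign.+
σ₉ _  = Sign.-

torus₉-tail-forces : ∀ τ → NoMonochromaticFace τ (List⁺.tail torus₉) → τ ≈± σ₉
torus₉-tail-forces = from-yes (allStates? resp
  (λ τ → noMonochromaticFace? τ (List⁺.tail torus₉) →-dec ≈±? τ σ₉))
  where
  resp : ∀ {σ τ} → σ ≗ τ →
    (NoMonochromaticFace σ (List⁺.tail torus₉) → σ ≈± σ₉) →
    (NoMonochromaticFace τ (List⁺.tail torus₉) → τ ≈± σ₉)
  resp σ≗τ forces τ-ok =
    ≈±-respˡ σ≗τ (forces (All.map (λ {f} τf≡0 → trans (faceExcess-cong σ≗τ f) τf≡0) τ-ok))

-- Repeated stacking

stackedTorus : (m : ℕ) → List⁺ (Face (9 ℕ.+ m))
stackedTorus zero    = torus₉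
stackedTorus (suc m) = stack (stackedTorus m)

stackedTorus-isSurface : ∀ m → IsSurface (9 ℕ.+ m) (toList (stackedTorus m))
stackedTorus-isSurface zero    = Torus₉.isSurface
stackedTorus-isSurface (suc m) = Stacking.isSurface (stackedTorus-isSurface m)

stackedTorus-length : ∀ m → length (toList (stackedTorus m)) ≡ 2 ℕ.* (9 ℕ.+ m)
stackedTorus-length zero    = refl
stackedTorus-length (suc m) = begin
  3 ℕ.+ length (map shift (List⁺.tail (stackedTorus m)))
    ≡⟨ cong (3 ℕ.+_) (ListP.length-map shift (List⁺.tail (stackedTorus m))) ⟩
  2 ℕ.+ length (toList (stackedTorus m))
    ≡⟨ cong (2 ℕ.+_) (stackedTorus-length m) ⟩
  2 ℕ.+ 2 ℕ.* (9 ℕ.+ m)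
    ≡⟨ ℕP.*-distribˡ-+ 2 1 (9 ℕ.+ m) ⟨
  2 ℕ.* (10 ℕ.+ m) ∎
  where open ≡-Reasoning

stackedTriangulation : ℕ → TorusTriangulation
stackedTriangulation m = record
  { nV = 9 ℕ.+ m
  ; faces = toList (stackedTorus m)
  ; isTorus = record
    { faceDistinct = faceDistinct
    ; dirUnique = dirUnique
    ; dirSym = dirSym
    ; linkCycle = linkCycle
    ; connected = connected
    ; euler = euler-characteristic surface (stackedTorus-length m)
    }
  }
  where
  surface : IsSurface (9 ℕ.+ m) (toList (stackedTorus m))
  surface = stackedTorus-isSurface m
  open IsSurface surface

corner₁ corner₂ corner₃ : ∀ m → Fin (9 ℕ.+ m)
corner₁ m = proj₁ (List⁺.head (stackedTorus m))
corner₂ m = proj₁ (proj₂ (List⁺.head (stackedTorus m)))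
corner₃ m = proj₂ (proj₂ (List⁺.head (stackedTorus m)))

stackedState : ∀ m → Fin (9 ℕ.+ m) → Sign
stackedState zero    = σ₉
stackedState (suc m) = opposite (stackedState m (corner₁ m)) ◂ stackedState m

stackedState-corner₂ : ∀ m → stackedState m (corner₂ m) ≡ Sign.+
stackedState-corner₂ zero    = refl
stackedState-corner₂ (suc m) = stackedState-corner₂ m

stackedState-corner₃ : ∀ m → stackedState m (corner₃ m) ≡ Sign.-
stackedState-corner₃ zero    = refl
stackedState-corner₃ (suc m) = stackedState-corner₃ m

stackedState-tail-noMonochromaticFace : ∀ m →
  NoMonochromaticFace (stackedState m) (List⁺.tail (stackedTorus m))
stackedState-tail-noMonochromaticFace zero    = from-yes (noMonochromaticFace? σ₉ (List⁺.tail torus₉))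
stackedState-tail-noMonochromaticFace (suc m) =
  excess-opposite₁ _ _ ∷ excess-opposite₂ _ _ ∷ AllP.map⁺ (stackedState-tail-noMonochromaticFace m)

stackedState-noMonochromaticFace : ∀ m → NoMonochromaticFace (stackedState m) (toList (stackedTorus m))
stackedState-noMonochromaticFace m =
  subst₂ (λ y z → excess (stackedState m (corner₁ m)) y z ≡ 0)
         (sym (stackedState-corner₂ m)) (sym (stackedState-corner₃ m)) (excess-+- _)
  ∷ stackedState-tail-noMonochromaticFace m

stackedTorus-tail-forces : ∀ m τ →
  NoMonochromaticFace τ (List⁺.tail (stackedTorus m)) → τ ≈± stackedState m
stackedTorus-tail-forces zero          = torus₉-tail-forces
stackedTorus-tail-forces (suc m) τ (ok₁ ∷ ok₂ ∷ ok) =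
  ≈±-◂ τ∘suc≈σ (excess-forces-opposite _ _ _ _ ok₁ ok₂ (≈±-≢ τ∘suc≈σ corners-differ))
  where
  τ∘suc≈σ : τ ∘ suc ≈± stackedState m
  τ∘suc≈σ = stackedTorus-tail-forces m (τ ∘ suc) (AllP.map⁻ ok)
  corners-differ : stackedState m (corner₂ m) ≢ stackedState m (corner₃ m)
  corners-differ e with trans (sym (stackedState-corner₂ m)) (trans e (stackedState-corner₃ m))
  ... | ()

stackedTriangulation-nonDegenerate : ∀ m → NonDegenerate (stackedTriangulation m)
stackedTriangulation-nonDegenerate m =
  stackedState m ,
  noMonochromaticFace⇒groundstate (stackedState m) (stackedState-noMonochromaticFace m) ,
  λ τ τ-ground → stackedTorus-tail-forces m τ
    (All.tail (groundstate⇒noMonochromaticFace (stackedState m) (stackedState-noMonochromaticFace m) τ τ-ground))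
  where open Groundstates (stackedTriangulation m)

theorem2 : (n : ℕ) → 0 < n → Σ TorusTriangulation (λ T → n ≤ nV T × NonDegenerate T)
theorem2 n _ = stackedTriangulation n , ℕP.m≤n+m n 9 , stackedTriangulation-nonDegenerate n
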